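{- Let $\{G_n\}$ be a positive linear recurrence sequence with recurrence $G_{n+1}=c_1G_n+\cdots+c_LG_{n+1-L}$, and suppose $c_1\ge c_2\ge\cdots\ge c_L$. Then legal decompositions are given by the greedy algorithm: if $\sum_{j=1}^n a_jG_{n+1-j}$ is a legal decomposition, then for every $1\le k<n$ we have $\sum_{j=k+1}^n a_jG_{n+1-j}<G_{n+1-k}$; equivalently, the legal decomposition of each positive integer $N$ is obtained by repeatedly taking the largest $G_i\le$ (remaining value) as many times as possible and continuing with the remainder.
   Context: A positive linear recurrence sequence (PLRS) is a sequence $\{G_n\}_{n\ge1}$ of positive integers for which there are non-negative integers $L,c_1,\dots,c_L$ with $L,c_1,c_L$ positive such that $G_{n+1}=c_1G_n+\cdots+c_LG_{n+1-L}$ for $n\ge L$, with initial conditions $G_1=1$ and $G_{n+1}=c_1G_n+\cdots+c_nG_1+1$ for $1\le n<L$. A decomposition $N=\sum_{i=1}^{k}a_iG_{k+1-i}$ of a positive integer $N$ is legal if $a_1>0$, the other $a_i\ge0$, and either (1) $k<L$ and $a_i=c_i$ for $1\le i\le k$; or (2) there exists $s\in\{0,\dots,L\}$ with $a_1=c_1,\dots,a_{s-1}=c_{s-1}$, $a_s<c_s$, $a_{s+1}=\cdots=a_{s+\ell}=0$ for some $\ell\ge0$, and $(a_{s+\ell+1},\dots,a_k)$ is legal (the recursion terminating with the empty sequence). Every positive integer has a unique legal decomposition. -}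

module Defs where

open import Data.Nat using (ℕ; zero; suc; _+_; _*_; _∸_; _≤_; _<_; _≥_)
open import Data.List using (List; []; _∷_; length; take; drop; replicate; _++_)
open import Data.List.Relation.Unary.Linked using (Linked)
open import Data.Product using (_×_; ∃; ∃-syntax)
open import Data.Sum using (_⊎_)
open import Relation.Binary.PropositionalEquality using (_≡_)

-- The coefficient list cs = [c₁, …, c_L]; L = length cs.
-- i-th entry (0-based), defaulting to 0 out of range.
nth : List ℕ → ℕ → ℕ
nth []       _       = 0
nth (c ∷ cs) zero    = c
nth (c ∷ cs) (suc i) = nth cs i

lc : (ℕ → ℕ) → List ℕ → ℕ → ℕ
lc G []       n = 0
lc G (d ∷ ds) n = d * G n + lc G ds (n ∸ 1)

ValidCoeffs : List ℕ → Set
ValidCoeffs cs = 1 ≤ length cs × 0 < nth cs 0 × 0 < nth cs (length cs ∸ 1)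

-- G : ℕ → ℕ is the PLRS with coefficients cs (indices start at 1; G 0 is irrelevant).
IsPLRS : List ℕ → (ℕ → ℕ) → Set
IsPLRS cs G =
  G 1 ≡ 1
  × (∀ n → 1 ≤ n → n < length cs → G (suc n) ≡ lc G (take n cs) n + 1)
  × (∀ n → length cs ≤ n → G (suc n) ≡ lc G cs n)

-- The empty sequence is legal (termination of the recursion); non-empty legal
-- sequences have positive first entry.
data Legal (cs : List ℕ) : List ℕ → Set where
  nil    : Legal cs []
  prefix : ∀ a as → 0 < a → length (a ∷ as) < length cs →
           a ∷ as ≡ take (length (a ∷ as)) cs → Legal cs (a ∷ as)
  -- (2): s = suc t ∈ {1,…,L}: a₁ = c₁, …, a_{s-1} = c_{s-1}, a_s = x < c_s,
  --      followed by ℓ zeros, followed by a legal sequence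
  block  : ∀ a as (t x ℓ : ℕ) (rest : List ℕ) → 0 < a → t < length cs →
           x < nth cs t → Legal cs rest →
           a ∷ as ≡ take t cs ++ (x ∷ (replicate ℓ 0 ++ rest)) →
           Legal cs (a ∷ as)

LegalDecomposition : List ℕ → List ℕ → Set
LegalDecomposition cs as = 1 ≤ length as × Legal cs as

val : (ℕ → ℕ) → List ℕ → ℕ
val G []       = 0
val G (a ∷ as) = a * G (suc (length as)) + val G as

NonIncreasing : List ℕ → Set
NonIncreasing cs = Linked _≥_ cs

module Submission where

-- Call a digit list ds "good" when val G ds < G (1 + length ds): its value lies
-- below the next term of the sequence.  We show that every suffix of a legal
-- sequence is good, which is the theorem (for the suffixes after the first k
-- digits).
--
-- The engine is the "branching" step: if y < c_{j+1} and es is good, then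
-- c₁ … c_j y es is good, because its value is below
-- c₁G_n + ⋯ + c_{j+1}G_{n-j}, a partial sum of the recurrence, hence ≤ G_{n+1}.
-- The prefixes c₁ … c_j (j < L) are good by the initial conditions.  A suffix
-- c_{i+1} … c_t x ⋯ of a legal block starts with a run that is entrywise
-- dominated by c₁ c₂ … (this is where monotonicity of the c_i enters); walking
-- along the run, the first strict inequality reduces to the branching step, and
-- if there is none we land on c₁ … c_p x ⋯, again a branching step.

open import Defs
open import Data.Nat using (ℕ; suc; _∸_; _≤_; _<_)
open import Data.List using (List; length; drop)
open import Data.Nat using (zero; _+_; _*_; _≥_; z≤n; s≤s; _<?_)
open import Data.Nat.Properties
open import Data.List using ([]; _∷_; _++_; take; replicate)
open import Data.List.Properties using (length-++; length-drop; ++-assoc; ++-identityʳ; take-all)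
open import Data.List.Relation.Unary.Linked using (Linked; _∷_; tail)
open import Data.Product using (_,_; proj₁; proj₂)
open import Data.Sum using (inj₁; inj₂)
open import Relation.Nullary using (yes; no)
open import Relation.Binary.PropositionalEquality

-- Unlike take/drop it
-- always has length n and its entries are given by nth.
window : List ℕ → ℕ → ℕ → List ℕ
window ds i zero    = []
window ds i (suc n) = nth ds i ∷ window ds (suc i) n

length-window : ∀ ds i n → length (window ds i n) ≡ n
length-window ds i zero    = refl
length-window ds i (suc n) = cong suc (length-window ds (suc i) n)

window-shift : ∀ c ds i n → window (c ∷ ds) (suc i) n ≡ window ds i n
window-shift c ds i zero    = refl
window-shift c ds i (suc n) = cong (nth ds i ∷_) (window-shift c ds (suc i) n)

take≡window : ∀ ds n → n ≤ length ds → take n ds ≡ window ds 0 n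
take≡window ds       zero    _         = refl
take≡window (c ∷ ds) (suc n) (s≤s n≤) =
  cong (c ∷_) (trans (take≡window ds n n≤) (sym (window-shift c ds 0 n)))

window-snoc : ∀ ds i n → window ds i (suc n) ≡ window ds i n ++ nth ds (i + n) ∷ []
window-snoc ds i zero    = cong (λ m → nth ds m ∷ []) (sym (+-identityʳ i))
window-snoc ds i (suc n) = cong (nth ds i ∷_) (begin
  window ds (suc i) (suc n)                          ≡⟨ window-snoc ds (suc i) n ⟩
  window ds (suc i) n ++ nth ds (suc i + n) ∷ []     ≡⟨ cong (λ m → window ds (suc i) n ++ nth ds m ∷ []) (sym (+-suc i n)) ⟩
  window ds (suc i) n ++ nth ds (i + suc n) ∷ []     ∎)
  where open ≡-Reasoning

val≡lc : ∀ G ds → val G ds ≡ lc G ds (length ds)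
val≡lc G []       = refl
val≡lc G (a ∷ as) = cong (a * G (suc (length as)) +_) (val≡lc G as)

lc-++ : ∀ G xs ys n → lc G (xs ++ ys) n ≡ lc G xs n + lc G ys (n ∸ length xs)
lc-++ G []       ys n = refl
lc-++ G (x ∷ xs) ys n = begin
  x * G n + lc G (xs ++ ys) (n ∸ 1)                           ≡⟨ cong (x * G n +_) (lc-++ G xs ys (n ∸ 1)) ⟩
  x * G n + (lc G xs (n ∸ 1) + lc G ys (n ∸ 1 ∸ length xs))   ≡⟨ sym (+-assoc (x * G n) _ _) ⟩
  x * G n + lc G xs (n ∸ 1) + lc G ys (n ∸ 1 ∸ length xs)     ≡⟨ cong (λ m → x * G n + lc G xs (n ∸ 1) + lc G ys m) (∸-+-assoc n 1 (length xs)) ⟩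
  x * G n + lc G xs (n ∸ 1) + lc G ys (n ∸ suc (length xs))   ∎
  where open ≡-Reasoning

val-++ : ∀ G xs ys → val G (xs ++ ys) ≡ lc G xs (length xs + length ys) + val G ys
val-++ G xs ys = begin
  val G (xs ++ ys)                                ≡⟨ val≡lc G (xs ++ ys) ⟩
  lc G (xs ++ ys) (length (xs ++ ys))             ≡⟨ cong (lc G (xs ++ ys)) (length-++ xs) ⟩
  lc G (xs ++ ys) n                               ≡⟨ lc-++ G xs ys n ⟩
  lc G xs n + lc G ys (n ∸ length xs)             ≡⟨ cong (λ m → lc G xs n + lc G ys m) (m+n∸m≡n (length xs) (length ys)) ⟩
  lc G xs n + lc G ys (length ys)                 ≡⟨ cong (lc G xs n +_) (sym (val≡lc G ys)) ⟩
  lc G xs n + val G ys                            ∎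
  where
  open ≡-Reasoning
  n = length xs + length ys

lc-window-snoc : ∀ G ds j n →
  lc G (window ds 0 (suc j)) n ≡ lc G (window ds 0 j) n + nth ds j * G (n ∸ j)
lc-window-snoc G ds j n = begin
  lc G (window ds 0 (suc j)) n                                ≡⟨ cong (λ w → lc G w n) (window-snoc ds 0 j) ⟩
  lc G (w ++ nth ds j ∷ []) n                                 ≡⟨ lc-++ G w (nth ds j ∷ []) n ⟩
  lc G w n + (nth ds j * G (n ∸ length w) + 0)                ≡⟨ cong (lc G w n +_) (+-identityʳ _) ⟩
  lc G w n + nth ds j * G (n ∸ length w)                      ≡⟨ cong (λ m → lc G w n + nth ds j * G (n ∸ m)) (length-window ds 0 j) ⟩
  lc G w n + nth ds j * G (n ∸ j)                             ∎
  where
  open ≡-Reasoning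
  w = window ds 0 j

lc-window-mono : ∀ G ds i n {u v} → u ≤ v → lc G (window ds i u) n ≤ lc G (window ds i v) n
lc-window-mono G ds i n {zero}  _         = z≤n
lc-window-mono G ds i n {suc u} (s≤s u≤v) =
  +-monoʳ-≤ (nth ds i * G n) (lc-window-mono G ds (suc i) (n ∸ 1) u≤v)

nth-pos⇒< : ∀ ds j → 0 < nth ds j → j < length ds
nth-pos⇒< (c ∷ ds) zero    _ = s≤s z≤n
nth-pos⇒< (c ∷ ds) (suc j) p = s≤s (nth-pos⇒< ds j p)

nth≤head : ∀ c ds → Linked _≥_ (c ∷ ds) → ∀ i → nth (c ∷ ds) i ≤ c
nth≤head c ds       _          zero    = ≤-refl
nth≤head c []       _          (suc i) = z≤n
nth≤head c (d ∷ ds) (c≥d ∷ ni) (suc i) = ≤-trans (nth≤head d ds ni i) c≥d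

nth-antitone : ∀ ds → Linked _≥_ ds → ∀ {j i} → j ≤ i → nth ds i ≤ nth ds j
nth-antitone []       _  _                     = z≤n
nth-antitone (c ∷ ds) ni {zero}  {i}     _         = nth≤head c ds ni i
nth-antitone (c ∷ ds) ni {suc j} {suc i} (s≤s j≤i) = nth-antitone ds (tail ni) j≤i

module PLRS (cs : List ℕ) (G : ℕ → ℕ) (plrs : IsPLRS cs G) where

  L : ℕ
  L = length cs

  Good : List ℕ → Set
  Good ds = val G ds < G (suc (length ds))

  good-[] : Good []
  good-[] = ≤-reflexive (sym (proj₁ plrs))

  initial-window : ∀ n → 1 ≤ n → n < L → G (suc n) ≡ lc G (window cs 0 n) n + 1
  initial-window n 1≤n n<L = trans (proj₁ (proj₂ plrs) n 1≤n n<L)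
    (cong (λ w → lc G w n + 1) (take≡window cs n (<⇒≤ n<L)))

  recurrence-window : ∀ n → L ≤ n → G (suc n) ≡ lc G (window cs 0 L) n
  recurrence-window n L≤n = trans (proj₂ (proj₂ plrs) n L≤n)
    (cong (λ w → lc G w n) (trans (sym (take-all L cs ≤-refl)) (take≡window cs L ≤-refl)))

  partial-sum-bound : ∀ u n → u ≤ L → u ≤ n → lc G (window cs 0 u) n ≤ G (suc n)
  partial-sum-bound zero    n _   _   = z≤n
  partial-sum-bound (suc u) n u≤L u≤n with n <? L
  ... | yes n<L = begin
    lc G (window cs 0 (suc u)) n  ≤⟨ lc-window-mono G cs 0 n u≤n ⟩
    lc G (window cs 0 n) n        ≤⟨ m≤m+n _ 1 ⟩
    lc G (window cs 0 n) n + 1    ≡⟨ sym (initial-window n (≤-trans (s≤s z≤n) u≤n) n<L) ⟩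
    G (suc n)                     ∎
    where open ≤-Reasoning
  ... | no n≮L = begin
    lc G (window cs 0 (suc u)) n  ≤⟨ lc-window-mono G cs 0 n u≤L ⟩
    lc G (window cs 0 L) n        ≡⟨ sym (recurrence-window n (≮⇒≥ n≮L)) ⟩
    G (suc n)                     ∎
    where open ≤-Reasoning

  good-window : ∀ j → j < L → Good (window cs 0 j)
  good-window zero    _   = good-[]
  good-window (suc j) j<L = begin-strict
    val G w                          ≡⟨ val≡lc G w ⟩
    lc G w (length w)                ≡⟨ cong (lc G w) (length-window cs 0 (suc j)) ⟩
    lc G w (suc j)                   <⟨ m<m+n _ (s≤s z≤n) ⟩
    lc G w (suc j) + 1               ≡⟨ sym (initial-window (suc j) (s≤s z≤n) j<L) ⟩
    G (suc (suc j))                  ≡⟨ cong (λ m → G (suc m)) (sym (length-window cs 0 (suc j))) ⟩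
    G (suc (length w))               ∎
    where
    open ≤-Reasoning
    w = window cs 0 (suc j)

  -- Branching step: if y < c_{j+1} and es is good, then c₁ … c_j y es is good,
  -- since its value is below the partial sum c₁G_n + ⋯ + c_{j+1}G_{n-j}.
  good-branch : ∀ j y es → y < nth cs j → Good es → Good (window cs 0 j ++ y ∷ es)
  good-branch j y es y<c es-good = begin-strict
    val G (w ++ y ∷ es)                    ≡⟨ val-++ G w (y ∷ es) ⟩
    lc G w (length w + suc e) + val G (y ∷ es)
                                           ≡⟨ cong (λ m → lc G w (m + suc e) + val G (y ∷ es)) (length-window cs 0 j) ⟩
    lc G w n + (y * g + val G es)          <⟨ +-monoʳ-< (lc G w n) (+-monoʳ-< (y * g) es-good) ⟩
    lc G w n + (y * g + g)                 ≡⟨ cong (lc G w n +_) (+-comm (y * g) g) ⟩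
    lc G w n + suc y * g                   ≤⟨ +-monoʳ-≤ (lc G w n) (*-monoˡ-≤ g y<c) ⟩
    lc G w n + nth cs j * g                ≡⟨ cong (λ m → lc G w n + nth cs j * G m) (sym (m+n∸m≡n j (suc e))) ⟩
    lc G w n + nth cs j * G (n ∸ j)        ≡⟨ sym (lc-window-snoc G cs j n) ⟩
    lc G (window cs 0 (suc j)) n           ≤⟨ partial-sum-bound (suc j) n j<L (m<m+n j (s≤s z≤n)) ⟩
    G (suc n)                              ≡⟨ cong (λ m → G (suc m)) (sym length-eq) ⟩
    G (suc (length (w ++ y ∷ es)))         ∎
    where
    open ≤-Reasoning
    w = window cs 0 j
    e = length es
    n = j + suc e
    g = G (suc e)
    j<L : j < L
    j<L = nth-pos⇒< cs j (≤-<-trans z≤n y<c)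
    length-eq : length (w ++ y ∷ es) ≡ n
    length-eq = trans (length-++ w) (cong (_+ suc e) (length-window cs 0 j))

module Greedy (cs : List ℕ) (G : ℕ → ℕ) (plrs : IsPLRS cs G)
              (ni : NonIncreasing cs) (c₁-pos : 0 < nth cs 0) where

  open PLRS cs G plrs

  AllGood : List ℕ → Set
  AllGood xs = ∀ k → Good (drop k xs)

  all-good-[] : AllGood []
  all-good-[] zero    = good-[]
  all-good-[] (suc k) = good-[]

  all-good-∷ : ∀ {x xs} → Good (x ∷ xs) → AllGood xs → AllGood (x ∷ xs)
  all-good-∷ x-good _   zero    = x-good
  all-good-∷ _      all (suc k) = all k

  data Dominated : ℕ → List ℕ → Set where
    []  : ∀ {j} → Dominated j []
    _∷_ : ∀ {j q q′} → q ≤ nth cs j → Dominated (suc j) q′ → Dominated j (q ∷ q′)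

  dominated-window : ∀ j i n → j ≤ i → Dominated j (window cs i n)
  dominated-window j i zero    _   = []
  dominated-window j i (suc n) j≤i =
    nth-antitone cs ni j≤i ∷ dominated-window (suc j) (suc i) n (s≤s j≤i)

  -- Following a dominated run q after c₁ … c_j: at the first strict inequality
  -- the branching step applies; if q matches the coefficients throughout, the
  -- list is c₁ … c_{j+|q|} r, good by hypothesis.
  dominated-good : ∀ j q r → Dominated j q → Good (window cs 0 (j + length q) ++ r) →
                   (∀ k → Good (drop (suc k) (q ++ r))) → Good (window cs 0 j ++ q ++ r)
  dominated-good j [] r [] full-good _ =
    subst (λ m → Good (window cs 0 m ++ r)) (+-identityʳ j) full-good
  dominated-good j (q ∷ q′) r (q≤c ∷ dom) full-good tails with m≤n⇒m<n∨m≡n q≤c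
  ... | inj₁ q<c  = good-branch j q (q′ ++ r) q<c (tails 0)
  ... | inj₂ refl = subst Good regroup
    (dominated-good (suc j) q′ r dom
      (subst (λ m → Good (window cs 0 m ++ r)) (+-suc j (length q′)) full-good)
      (λ k → tails (suc k)))
    where
    regroup : window cs 0 (suc j) ++ q′ ++ r ≡ window cs 0 j ++ nth cs j ∷ q′ ++ r
    regroup = trans (cong (_++ q′ ++ r) (window-snoc cs 0 j))
                    (++-assoc (window cs 0 j) (nth cs j ∷ []) (q′ ++ r))

  Closes : ℕ → List ℕ → Set
  Closes t r = ∀ p → p ≤ t → Good (window cs 0 p ++ r)

  all-good-window : ∀ t r → AllGood r → Closes t r → ∀ i n → i + n ≡ t →
                    AllGood (window cs i n ++ r)
  all-good-window t r r-good closes i zero    _   = r-good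
  all-good-window t r r-good closes i (suc n) i+n≡t = all-good-∷ head-good rest-good
    where
    rest-good : AllGood (window cs (suc i) n ++ r)
    rest-good = all-good-window t r r-good closes (suc i) n (trans (sym (+-suc i n)) i+n≡t)
    n<t : suc n ≤ t
    n<t = subst (suc n ≤_) i+n≡t (m≤n+m (suc n) i)
    head-good : Good (window cs i (suc n) ++ r)
    head-good = dominated-good 0 (window cs i (suc n)) r (dominated-window 0 i (suc n) z≤n)
      (subst (λ m → Good (window cs 0 m ++ r)) (sym (length-window cs i (suc n))) (closes (suc n) n<t))
      rest-good

  all-good-zeros : ∀ ℓ zs → AllGood zs → AllGood (replicate ℓ 0 ++ zs)
  all-good-zeros zero    zs zs-good = zs-good
  all-good-zeros (suc ℓ) zs zs-good =
    all-good-∷ (good-branch 0 0 (replicate ℓ 0 ++ zs) c₁-pos (rest-good 0)) rest-good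
    where
    rest-good : AllGood (replicate ℓ 0 ++ zs)
    rest-good = all-good-zeros ℓ zs zs-good

  legal-all-good : ∀ as → Legal cs as → AllGood as
  legal-all-good [] nil = all-good-[]
  legal-all-good (a ∷ as) (prefix a as _ m<L as≡) =
    subst AllGood (sym (trans as≡ (trans (take≡window cs m (<⇒≤ m<L)) (sym (++-identityʳ (window cs 0 m))))))
      (all-good-window m [] all-good-[] closes 0 m refl)
    where
    m = length (a ∷ as)
    closes : Closes m []
    closes p p≤m = subst Good (sym (++-identityʳ (window cs 0 p))) (good-window p (≤-<-trans p≤m m<L))
  legal-all-good (a ∷ as) (block a as t x ℓ rest _ t<L x<c legal as≡) =
    subst AllGood (sym (trans as≡ (cong (_++ x ∷ tl) (take≡window cs t (<⇒≤ t<L)))))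
      (all-good-window t (x ∷ tl) (all-good-∷ (closes 0 z≤n) tl-good) closes 0 t refl)
    where
    tl = replicate ℓ 0 ++ rest
    tl-good : AllGood tl
    tl-good = all-good-zeros ℓ rest (legal-all-good rest legal)
    closes : Closes t (x ∷ tl)
    closes p p≤t = good-branch p x tl (<-≤-trans x<c (nth-antitone cs ni p≤t)) (tl-good 0)

mainTheorem4 : (cs : List ℕ) (G : ℕ → ℕ) → ValidCoeffs cs → IsPLRS cs G →
    NonIncreasing cs → (as : List ℕ) → LegalDecomposition cs as →
    (k : ℕ) → 1 ≤ k → k < length as →
    val G (drop k as) < G (suc (length as ∸ k))
mainTheorem4 cs G (_ , c₁-pos , _) plrs ni as (_ , legal) k _ _ =
  subst (λ m → val G (drop k as) < G (suc m)) (length-drop k as)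
    (Greedy.legal-all-good cs G plrs ni c₁-pos as legal k)
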